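{- Let $V=\{a_1,b_1,a_2,b_2,a_3,b_3\}$ (six distinct elements), $\mathcal{E}_2=\binom{V}{3}\setminus\{\{a_1,b_2,b_3\},\{a_2,b_1,b_3\},\{a_3,b_1,b_2\},\{a_1,a_2,a_3\}\}$ and $\mathcal{E}_3=\binom{V}{3}\setminus\{\{a_1,b_2,b_3\},\{a_2,b_1,b_3\},\{a_3,b_1,b_2\}\}$. Then both $\mathcal{F}_2=(V,\mathcal{E}_2)$ and $\mathcal{F}_3=(V,\mathcal{E}_3)$ are minimal non-metric hypergraphs: neither is metric, but every sub-hypergraph of either one induced by a proper subset of $V$ is metric.
   Context: $\binom{V}{3}$ denotes the set of three-element subsets of $V$. A $3$-uniform hypergraph $(V,\mathcal{E})$ is metric if there is a metric $\mathrm{dist}$ on $V$ such that $\mathcal{E}=\{\{u,v,w\}: u,v,w \text{ pairwise distinct and } \mathrm{dist}(u,v)+\mathrm{dist}(v,w)=\mathrm{dist}(u,w)\}$. For $W\subseteq V$, the sub-hypergraph induced by $W$ is $(W,\{E\in\mathcal{E}:E\subseteq W\})$.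
   Formalization: The metric dist in the definition of a metric hypergraph, and of its induced sub-hypergraphs, takes values in the rationals. -}

module Defs where

open import Data.Nat using (ℕ)
open import Data.Fin using (Fin; zero; suc)
open import Data.Fin.Subset using (Subset; ⊤; _⊂_; _∈_; _⊆_; ⁅_⁆; _∪_; ∣_∣)
open import Data.Rational using (ℚ; 0ℚ; _+_; _≤_)
open import Data.Product using (Σ; ∃; _×_)
open import Relation.Binary.PropositionalEquality using (_≡_; _≢_)
open import Relation.Nullary using (¬_)
open import Function.Bundles using (_⇔_)

-- A 3-uniform hypergraph on (a subset W of) Fin n is given by its edge
-- predicate on subsets of Fin n (edges are 3-element subsets).
Hyperedges : ℕ → Set₁
Hyperedges n = Subset n → Set

record IsMetricOn {n : ℕ} (W : Subset n) (dist : Fin n → Fin n → ℚ) : Set where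
  field
    zero-iff : ∀ {x y} → x ∈ W → y ∈ W → (dist x y ≡ 0ℚ) ⇔ (x ≡ y)
    symmetric : ∀ {x y} → x ∈ W → y ∈ W → dist x y ≡ dist y x
    triangle : ∀ {x y z} → x ∈ W → y ∈ W → z ∈ W →
               dist x z ≤ dist x y + dist y z

BetweenTriple : {n : ℕ} → (Fin n → Fin n → ℚ) → Subset n → Set
BetweenTriple {n} dist S =
  Σ (Fin n) λ u → Σ (Fin n) λ v → Σ (Fin n) λ w →
    u ≢ v × v ≢ w × u ≢ w ×
    S ≡ ⁅ u ⁆ ∪ ⁅ v ⁆ ∪ ⁅ w ⁆ ×
    dist u v + dist v w ≡ dist u w

InducedMetric : {n : ℕ} → Hyperedges n → Subset n → Set
InducedMetric {n} E W =
  Σ (Fin n → Fin n → ℚ) λ dist →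
    IsMetricOn W dist ×
    (∀ S → S ⊆ W → (E S ⇔ BetweenTriple dist S))

a₁ b₁ a₂ b₂ a₃ b₃ : Fin 6
a₁ = zero
b₁ = suc zero
a₂ = suc (suc zero)
b₂ = suc (suc (suc zero))
a₃ = suc (suc (suc (suc zero)))
b₃ = suc (suc (suc (suc (suc zero))))

triple : Fin 6 → Fin 6 → Fin 6 → Subset 6
triple x y z = ⁅ x ⁆ ∪ ⁅ y ⁆ ∪ ⁅ z ⁆

ℰ₃ : Hyperedges 6
ℰ₃ S = ∣ S ∣ ≡ 3 ×
       S ≢ triple a₁ b₂ b₃ × S ≢ triple a₂ b₁ b₃ × S ≢ triple a₃ b₁ b₂

ℰ₂ : Hyperedges 6
ℰ₂ S = ℰ₃ S × S ≢ triple a₁ a₂ a₃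

MinimalNonMetric : {n : ℕ} → Hyperedges n → Set
MinimalNonMetric {n} E =
  ¬ InducedMetric E ⊤ ×
  (∀ W → W ⊂ ⊤ → InducedMetric E W)

-- Write B x y z for d x y + d y z ≡ d x z.  In a metric space B is symmetric in its outer
-- points and B x y z , B x z w give B x y w and B y z w; a triple is an edge of the
-- realised hypergraph exactly when one of its points lies between the other two.  If a
-- metric realised a hypergraph with ℰ₂ ⊆ E ⊆ ℰ₃, some bᵢ would lie between the other two b's;
-- after rotating the indices this is b₂, and five edges through a₁ and a₃ then force one of
-- the non-edges a₁b₂b₃, a₃b₁b₂ to be an edge.  Conversely every vertex-deleted sub-hypergraph
-- is realised by an integer metric; the rotation maps these to each other, so three distance
-- tables suffice, and each is verified by a finite computation.
module Submission where

open import Data.Nat using (ℕ) renaming (_≟_ to _≟ℕ_)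
open import Data.Bool.Properties using () renaming (_≟_ to _≟ᵇ_)
open import Data.Empty using (⊥-elim)
open import Data.Fin using (Fin)
open import Data.Fin.Properties using (any?; all?; decFinSubset) renaming (_≟_ to _≟ᶠ_)
open import Data.Fin.Subset using (Subset; ⊤; _⊂_; _∈_; _⊆_; ⁅_⁆; _∪_; ∁; ∣_∣)
open import Data.Fin.Subset.Properties
  using (∈⊤; _∈?_; _⊆?_; anySubset?; x∈⁅x⁆; x∈⁅y⁆⇒x≡y; x∈p∪q⁻; x∈p∪q⁺; x∉p⇒x∈∁p; ∪-assoc; ∪-comm)
open import Data.Integer using (+_)
open import Data.Product using (_×_; _,_; proj₁)
open import Data.Rational using (ℚ; 0ℚ; _+_; _≤_; _/_)
open import Data.Rational.Properties
  using (≤-antisym; +-assoc; +-comm; +-monoʳ-≤; +-monoʳ-<; <-≤-trans; <-irrefl; ≮⇒≥; module ≤-Reasoning)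
  renaming (_≟_ to _≟ℚ_; _≤?_ to _≤ℚ?_)
open import Data.Sum as Sum using (_⊎_; inj₁; inj₂)
open import Data.Vec using (Vec; []; _∷_; lookup)
open import Data.Vec.Properties using (≡-dec)
open import Function using (id; _∘_)
open import Function.Bundles using (_⇔_; mk⇔; Equivalence)
open import Relation.Binary.PropositionalEquality
  using (_≡_; _≢_; refl; cong; cong₂; subst; ≢-sym; module ≡-Reasoning) renaming (sym to ≡-sym)
open import Relation.Nullary using (¬_; Dec; ¬?)
open import Relation.Nullary.Decidable
  using (True; toWitness; decidable-stable; _×-dec_; _→-dec_) renaming (map to map-dec)

open import Defs

record IsBetweenness {A : Set} (B : A → A → A → Set) : Set where
  field
    sym    : ∀ {x y z} → B x y z → B z y x
    transˡ : ∀ {x y z w} → B x y z → B x z w → B x y w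
    transʳ : ∀ {x y z w} → B x y z → B x z w → B y z w

data Collinear {A : Set} (B : A → A → A → Set) (x y z : A) : Set where
  mid₁ : B y x z → Collinear B x y z
  mid₂ : B x y z → Collinear B x y z
  mid₃ : B x z y → Collinear B x y z

module _ {A : Set} {B : A → A → A → Set} (isB : IsBetweenness B) where
  open IsBetweenness isB

  five-point-obstruction : ∀ {a₁ b₁ b₂ a₃ b₃} →
    ¬ Collinear B a₁ b₂ b₃ → ¬ Collinear B a₃ b₁ b₂ →
    Collinear B a₁ b₁ b₂ → Collinear B a₁ b₂ a₃ → Collinear B b₁ a₃ b₃ →
    Collinear B b₂ a₃ b₃ → Collinear B a₁ b₁ b₃ →
    ¬ B b₁ b₂ b₃
  five-point-obstruction N₁ N₃ (mid₁ b₁a₁b₂) _ _ _ _ b₁b₂b₃ =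
    N₁ (mid₂ (transʳ b₁a₁b₂ b₁b₂b₃))
  five-point-obstruction N₁ N₃ (mid₂ a₁b₁b₂) (mid₁ b₂a₁a₃) _ _ _ _ =
    N₃ (mid₂ (sym (transˡ (sym a₁b₁b₂) b₂a₁a₃)))
  five-point-obstruction N₁ N₃ (mid₂ a₁b₁b₂) (mid₂ a₁b₂a₃) _ _ _ _ =
    N₃ (mid₃ (sym (transʳ a₁b₁b₂ a₁b₂a₃)))
  five-point-obstruction N₁ N₃ (mid₂ _) (mid₃ _) (mid₁ a₃b₁b₃) _ _ b₁b₂b₃ =
    N₃ (mid₂ (sym (transʳ (sym b₁b₂b₃) (sym a₃b₁b₃))))
  five-point-obstruction N₁ N₃ (mid₂ _) (mid₃ _) (mid₂ b₁a₃b₃) (mid₁ a₃b₂b₃) _ _ =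
    N₃ (mid₁ (sym (transʳ (sym a₃b₂b₃) (sym b₁a₃b₃))))
  five-point-obstruction N₁ N₃ (mid₂ _) (mid₃ _) (mid₂ _) (mid₂ b₂a₃b₃) _ b₁b₂b₃ =
    N₃ (mid₃ (transʳ (sym b₂a₃b₃) (sym b₁b₂b₃)))
  five-point-obstruction N₁ N₃ (mid₂ _) (mid₃ a₁a₃b₂) (mid₂ _) (mid₃ b₂b₃a₃) _ _ =
    N₁ (mid₃ (sym (transˡ b₂b₃a₃ (sym a₁a₃b₂))))
  five-point-obstruction N₁ N₃ (mid₂ _) (mid₃ _) (mid₃ b₁b₃a₃) _ _ b₁b₂b₃ =
    N₃ (mid₃ (sym (transˡ b₁b₂b₃ b₁b₃a₃)))
  five-point-obstruction N₁ N₃ (mid₃ a₁b₂b₁) _ _ _ (mid₁ b₁a₁b₃) _ =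
    N₁ (mid₁ (transʳ (sym a₁b₂b₁) b₁a₁b₃))
  five-point-obstruction N₁ N₃ (mid₃ _) _ _ _ (mid₂ a₁b₁b₃) b₁b₂b₃ =
    N₁ (mid₂ (sym (transˡ (sym b₁b₂b₃) (sym a₁b₁b₃))))
  five-point-obstruction N₁ N₃ (mid₃ _) _ _ _ (mid₃ a₁b₃b₁) b₁b₂b₃ =
    N₁ (mid₃ (sym (transʳ b₁b₂b₃ (sym a₁b₃b₁))))

Between : {A : Set} → (A → A → ℚ) → A → A → A → Set
Between d x y z = d x y + d y z ≡ d x z

+-cancelˡ-≤ : ∀ r {p q} → r + p ≤ r + q → p ≤ q
+-cancelˡ-≤ r r+p≤r+q = ≮⇒≥ λ q<p → <-irrefl refl (<-≤-trans (+-monoʳ-< r q<p) r+p≤r+q)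

module _ {A : Set} (d : A → A → ℚ) (d-sym : ∀ x y → d x y ≡ d y x) where
  open ≤-Reasoning

  between-sym : ∀ {x y z} → Between d x y z → Between d z y x
  between-sym {x} {y} {z} xyz = begin-equality
    d z y + d y x ≡⟨ +-comm (d z y) (d y x) ⟩
    d y x + d z y ≡⟨ cong₂ _+_ (d-sym y x) (d-sym z y) ⟩
    d x y + d y z ≡⟨ xyz ⟩
    d x z         ≡⟨ d-sym x z ⟩
    d z x         ∎

  module _ (triangle : ∀ x y z → d x z ≤ d x y + d y z) where

    path-length : ∀ {x y z w} → Between d x y z → Between d x z w →
                  d x w ≡ d x y + (d y z + d z w)
    path-length {x} {y} {z} {w} xyz xzw = begin-equality
      d x w                   ≡⟨ xzw ⟨
      d x z + d z w           ≡⟨ cong (_+ d z w) xyz ⟨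
      d x y + d y z + d z w   ≡⟨ +-assoc (d x y) (d y z) (d z w) ⟩
      d x y + (d y z + d z w) ∎

    between-transˡ : ∀ {x y z w} → Between d x y z → Between d x z w → Between d x y w
    between-transˡ {x} {y} {z} {w} xyz xzw = ≤-antisym
      (begin d x y + d y w           ≤⟨ +-monoʳ-≤ (d x y) (triangle y z w) ⟩
             d x y + (d y z + d z w) ≡⟨ path-length xyz xzw ⟨
             d x w                   ∎)
      (triangle x y w)

    between-transʳ : ∀ {x y z w} → Between d x y z → Between d x z w → Between d y z w
    between-transʳ {x} {y} {z} {w} xyz xzw = ≤-antisym
      (+-cancelˡ-≤ (d x y) (begin
        d x y + (d y z + d z w) ≡⟨ path-length xyz xzw ⟨
        d x w                   ≤⟨ triangle x y w ⟩
        d x y + d y w           ∎))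
      (triangle y z w)

    between-isBetweenness : IsBetweenness (Between d)
    between-isBetweenness = record
      { sym = between-sym ; transˡ = between-transˡ ; transʳ = between-transʳ }

module _ {n : ℕ} {x y z : Fin n} where

  ∈-triple : ∀ {t} → t ∈ ⁅ x ⁆ ∪ ⁅ y ⁆ ∪ ⁅ z ⁆ → t ≡ x ⊎ t ≡ y ⊎ t ≡ z
  ∈-triple t∈ = Sum.map (x∈⁅y⁆⇒x≡y x) (Sum.map (x∈⁅y⁆⇒x≡y y) (x∈⁅y⁆⇒x≡y z) ∘ x∈p∪q⁻ ⁅ y ⁆ ⁅ z ⁆)
                        (x∈p∪q⁻ ⁅ x ⁆ _ t∈)

  triple-∈₁ : x ∈ ⁅ x ⁆ ∪ ⁅ y ⁆ ∪ ⁅ z ⁆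
  triple-∈₁ = x∈p∪q⁺ (inj₁ (x∈⁅x⁆ x))

  triple-∈₂ : y ∈ ⁅ x ⁆ ∪ ⁅ y ⁆ ∪ ⁅ z ⁆
  triple-∈₂ = x∈p∪q⁺ (inj₂ (x∈p∪q⁺ (inj₁ (x∈⁅x⁆ y))))

  triple-∈₃ : z ∈ ⁅ x ⁆ ∪ ⁅ y ⁆ ∪ ⁅ z ⁆
  triple-∈₃ = x∈p∪q⁺ (inj₂ (x∈p∪q⁺ (inj₂ (x∈⁅x⁆ z))))

  triple-swap₁₂ : ⁅ x ⁆ ∪ ⁅ y ⁆ ∪ ⁅ z ⁆ ≡ ⁅ y ⁆ ∪ ⁅ x ⁆ ∪ ⁅ z ⁆
  triple-swap₁₂ = begin
    ⁅ x ⁆ ∪ (⁅ y ⁆ ∪ ⁅ z ⁆) ≡⟨ ∪-assoc ⁅ x ⁆ ⁅ y ⁆ ⁅ z ⁆ ⟨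
    (⁅ x ⁆ ∪ ⁅ y ⁆) ∪ ⁅ z ⁆ ≡⟨ cong (_∪ ⁅ z ⁆) (∪-comm ⁅ x ⁆ ⁅ y ⁆) ⟩
    (⁅ y ⁆ ∪ ⁅ x ⁆) ∪ ⁅ z ⁆ ≡⟨ ∪-assoc ⁅ y ⁆ ⁅ x ⁆ ⁅ z ⁆ ⟩
    ⁅ y ⁆ ∪ (⁅ x ⁆ ∪ ⁅ z ⁆) ∎
    where open ≡-Reasoning

  triple-swap₂₃ : ⁅ x ⁆ ∪ ⁅ y ⁆ ∪ ⁅ z ⁆ ≡ ⁅ x ⁆ ∪ ⁅ z ⁆ ∪ ⁅ y ⁆
  triple-swap₂₃ = cong (⁅ x ⁆ ∪_) (∪-comm ⁅ y ⁆ ⁅ z ⁆)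

module _ {n : ℕ} (d : Fin n → Fin n → ℚ) (d-sym : ∀ x y → d x y ≡ d y x) {x y z : Fin n} where

  betweenTriple⇒collinear : BetweenTriple d (⁅ x ⁆ ∪ ⁅ y ⁆ ∪ ⁅ z ⁆) → Collinear (Between d) x y z
  betweenTriple⇒collinear (u , v , w , u≢v , v≢w , u≢w , xyz≡uvw , uvw)
    with ∈-triple (subst (u ∈_) (≡-sym xyz≡uvw) triple-∈₁)
       | ∈-triple (subst (v ∈_) (≡-sym xyz≡uvw) triple-∈₂)
       | ∈-triple (subst (w ∈_) (≡-sym xyz≡uvw) triple-∈₃)
  ... | inj₁ refl        | inj₁ refl        | _                = ⊥-elim (u≢v refl)
  ... | inj₂ (inj₁ refl) | inj₂ (inj₁ refl) | _                = ⊥-elim (u≢v refl)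
  ... | inj₂ (inj₂ refl) | inj₂ (inj₂ refl) | _                = ⊥-elim (u≢v refl)
  ... | _                | inj₁ refl        | inj₁ refl        = ⊥-elim (v≢w refl)
  ... | _                | inj₂ (inj₁ refl) | inj₂ (inj₁ refl) = ⊥-elim (v≢w refl)
  ... | _                | inj₂ (inj₂ refl) | inj₂ (inj₂ refl) = ⊥-elim (v≢w refl)
  ... | inj₁ refl        | _                | inj₁ refl        = ⊥-elim (u≢w refl)
  ... | inj₂ (inj₁ refl) | _                | inj₂ (inj₁ refl) = ⊥-elim (u≢w refl)
  ... | inj₂ (inj₂ refl) | _                | inj₂ (inj₂ refl) = ⊥-elim (u≢w refl)
  ... | inj₂ (inj₁ refl) | inj₁ refl        | inj₂ (inj₂ refl) = mid₁ uvw
  ... | inj₂ (inj₂ refl) | inj₁ refl        | inj₂ (inj₁ refl) = mid₁ (between-sym d d-sym uvw)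
  ... | inj₁ refl        | inj₂ (inj₁ refl) | inj₂ (inj₂ refl) = mid₂ uvw
  ... | inj₂ (inj₂ refl) | inj₂ (inj₁ refl) | inj₁ refl        = mid₂ (between-sym d d-sym uvw)
  ... | inj₁ refl        | inj₂ (inj₂ refl) | inj₂ (inj₁ refl) = mid₃ uvw
  ... | inj₂ (inj₁ refl) | inj₂ (inj₂ refl) | inj₁ refl        = mid₃ (between-sym d d-sym uvw)

  collinear⇒betweenTriple : x ≢ y → y ≢ z → x ≢ z →
                            Collinear (Between d) x y z → BetweenTriple d (⁅ x ⁆ ∪ ⁅ y ⁆ ∪ ⁅ z ⁆)
  collinear⇒betweenTriple x≢y y≢z x≢z (mid₁ yxz) =
    y , x , z , ≢-sym x≢y , x≢z , y≢z , triple-swap₁₂ , yxz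
  collinear⇒betweenTriple x≢y y≢z x≢z (mid₂ xyz) =
    x , y , z , x≢y , y≢z , x≢z , refl , xyz
  collinear⇒betweenTriple x≢y y≢z x≢z (mid₃ xzy) =
    x , z , y , x≢z , ≢-sym y≢z , x≢y , triple-swap₂₃ , xzy

_≟ₛ_ : ∀ {n} (S T : Subset n) → Dec (S ≡ T)
_≟ₛ_ = ≡-dec _≟ᵇ_

ℰ₃? : ∀ S → Dec (ℰ₃ S)
ℰ₃? S = (∣ S ∣ ≟ℕ 3) ×-dec ¬? (S ≟ₛ triple a₁ b₂ b₃) ×-dec ¬? (S ≟ₛ triple a₂ b₁ b₃)
                     ×-dec ¬? (S ≟ₛ triple a₃ b₁ b₂)

ℰ₂? : ∀ S → Dec (ℰ₂ S)
ℰ₂? S = ℰ₃? S ×-dec ¬? (S ≟ₛ triple a₁ a₂ a₃)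

ℰ₂⊆E⊆ℰ₃⇒non-metric : ∀ {E : Hyperedges 6} → (∀ {S} → ℰ₂ S → E S) → (∀ {S} → E S → ℰ₃ S) →
                      ¬ InducedMetric E ⊤
ℰ₂⊆E⊆ℰ₃⇒non-metric ℰ₂⊆E E⊆ℰ₃ (d , metric , induces) = no-middle (collinear b₁ b₂ b₃)
  where
  open IsMetricOn metric

  d-sym : ∀ x y → d x y ≡ d y x
  d-sym x y = symmetric ∈⊤ ∈⊤

  B : Fin 6 → Fin 6 → Fin 6 → Set
  B = Between d

  isB : IsBetweenness B
  isB = between-isBetweenness d d-sym (λ x y z → triangle ∈⊤ ∈⊤ ∈⊤)

  collinear : ∀ x y z {_ : True (ℰ₂? (triple x y z))} → Collinear B x y z
  collinear x y z {edge} =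
    betweenTriple⇒collinear d d-sym (Equivalence.to (induces _ (λ _ → ∈⊤)) (ℰ₂⊆E (toWitness edge)))

  noncollinear : ∀ {x y z} → x ≢ y → y ≢ z → x ≢ z → ¬ ℰ₃ (triple x y z) → ¬ Collinear B x y z
  noncollinear x≢y y≢z x≢z non-edge = non-edge ∘ E⊆ℰ₃ ∘ Equivalence.from (induces _ (λ _ → ∈⊤))
                                      ∘ collinear⇒betweenTriple d d-sym x≢y y≢z x≢z

  N₁ : ¬ Collinear B a₁ b₂ b₃
  N₁ = noncollinear (λ ()) (λ ()) (λ ()) λ (_ , ≢N₁ , _) → ≢N₁ refl

  N₂ : ¬ Collinear B a₂ b₃ b₁
  N₂ = noncollinear (λ ()) (λ ()) (λ ()) λ (_ , _ , ≢N₂ , _) → ≢N₂ refl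

  N₃ : ¬ Collinear B a₃ b₁ b₂
  N₃ = noncollinear (λ ()) (λ ()) (λ ()) λ (_ , _ , _ , ≢N₃) → ≢N₃ refl

  -- The three cases are images of one another under the rotation aᵢ ↦ aᵢ₊₁, bᵢ ↦ bᵢ₊₁.
  no-middle : ¬ Collinear B b₁ b₂ b₃
  no-middle (mid₁ b₂b₁b₃) = five-point-obstruction isB N₃ N₂
    (collinear a₃ b₃ b₁) (collinear a₃ b₁ a₂) (collinear b₃ a₂ b₂) (collinear b₁ a₂ b₂) (collinear a₃ b₃ b₂)
    (IsBetweenness.sym isB b₂b₁b₃)
  no-middle (mid₂ b₁b₂b₃) = five-point-obstruction isB N₁ N₃
    (collinear a₁ b₁ b₂) (collinear a₁ b₂ a₃) (collinear b₁ a₃ b₃) (collinear b₂ a₃ b₃) (collinear a₁ b₁ b₃)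
    b₁b₂b₃
  no-middle (mid₃ b₁b₃b₂) = five-point-obstruction isB N₂ N₁
    (collinear a₂ b₂ b₃) (collinear a₂ b₃ a₁) (collinear b₂ a₁ b₁) (collinear b₃ a₁ b₁) (collinear a₂ b₂ b₁)
    (IsBetweenness.sym isB b₁b₃b₂)

_⇔-dec_ : ∀ {A B : Set} → Dec A → Dec B → Dec (A ⇔ B)
A? ⇔-dec B? = map-dec
  (mk⇔ (λ (to , from) → mk⇔ to from) (λ A⇔B → Equivalence.to A⇔B , Equivalence.from A⇔B))
  ((A? →-dec B?) ×-dec (B? →-dec A?))

allSubsets? : ∀ {n} {P : Subset n → Set} → (∀ S → Dec (P S)) → Dec (∀ S → P S)
allSubsets? P? = map-dec
  (mk⇔ (λ ∄¬P S → decidable-stable (P? S) (∄¬P ∘ (S ,_))) (λ ∀P (S , ¬PS) → ¬PS (∀P S)))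
  (¬? (anySubset? (¬? ∘ P?)))

module _ {n : ℕ} (W : Subset n) where

  all∈? : {P : Fin n → Set} → (∀ x → Dec (P x)) → Dec (∀ {x} → x ∈ W → P x)
  all∈? P? = decFinSubset (_∈? W) (λ {x} _ → P? x)

  isMetricOn? : (d : Fin n → Fin n → ℚ) → Dec (IsMetricOn W d)
  isMetricOn? d = map-dec (mk⇔
    (λ (z , s , t) → record
      { zero-iff  = λ {x} {y} p q → z {x} p {y} q
      ; symmetric = λ {x} {y} p q → s {x} p {y} q
      ; triangle  = λ {x} {y} {z} p q r → t {x} p {y} q {z} r })
    (λ m → let open IsMetricOn m in
      (λ {x} p {y} q → zero-iff {x} {y} p q) , (λ {x} p {y} q → symmetric {x} {y} p q) ,
      (λ {x} p {y} q {z} r → triangle {x} {y} {z} p q r)))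
    (all∈? (λ x → all∈? λ y → (d x y ≟ℚ 0ℚ) ⇔-dec (x ≟ᶠ y)) ×-dec
     all∈? (λ x → all∈? λ y → d x y ≟ℚ d y x) ×-dec
     all∈? (λ x → all∈? λ y → all∈? λ z → d x z ≤ℚ? d x y + d y z))

betweenTriple? : ∀ {n} (d : Fin n → Fin n → ℚ) S → Dec (BetweenTriple d S)
betweenTriple? d S = any? λ u → any? λ v → any? λ w →
  ¬? (u ≟ᶠ v) ×-dec ¬? (v ≟ᶠ w) ×-dec ¬? (u ≟ᶠ w) ×-dec
  (S ≟ₛ (⁅ u ⁆ ∪ ⁅ v ⁆ ∪ ⁅ w ⁆)) ×-dec (d u v + d v w ≟ℚ d u w)

IsInducedMetric : ∀ {n} → Hyperedges n → Subset n → (Fin n → Fin n → ℚ) → Set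
IsInducedMetric E W d = IsMetricOn W d × (∀ S → S ⊆ W → (E S ⇔ BetweenTriple d S))

isInducedMetric? : ∀ {n} {E : Hyperedges n} → (∀ S → Dec (E S)) → ∀ W d → Dec (IsInducedMetric E W d)
isInducedMetric? E? W d =
  isMetricOn? W d ×-dec allSubsets? λ S → (S ⊆? W) →-dec (E? S ⇔-dec betweenTriple? d S)

module _ {n : ℕ} {E : Hyperedges n} where

  induced-metric-⊆ : ∀ {W W′} → W ⊆ W′ → InducedMetric E W′ → InducedMetric E W
  induced-metric-⊆ W⊆W′ (d , metric , induces) =
    d , record { zero-iff = λ p q → zero-iff (W⊆W′ p) (W⊆W′ q)
               ; symmetric = λ p q → symmetric (W⊆W′ p) (W⊆W′ q)
               ; triangle = λ p q r → triangle (W⊆W′ p) (W⊆W′ q) (W⊆W′ r) }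
      , λ S S⊆W → induces S (λ p → W⊆W′ (S⊆W p))
    where open IsMetricOn metric

  proper-induced-metric : (∀ x → InducedMetric E (∁ ⁅ x ⁆)) → ∀ W → W ⊂ ⊤ → InducedMetric E W
  proper-induced-metric metric-without W (_ , x , _ , x∉W) =
    induced-metric-⊆ W⊆∁⁅x⁆ (metric-without x)
    where
    W⊆∁⁅x⁆ : W ⊆ ∁ ⁅ x ⁆
    W⊆∁⁅x⁆ y∈W = x∉p⇒x∈∁p λ y∈⁅x⁆ → x∉W (subst (_∈ W) (x∈⁅y⁆⇒x≡y x y∈⁅x⁆) y∈W)

  vertex-deleted-metrics : (E? : ∀ S → Dec (E S)) (ds : Vec (Fin n → Fin n → ℚ) n) →
    {_ : True (all? λ x → isInducedMetric? E? (∁ ⁅ x ⁆) (lookup ds x))} →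
    ∀ x → InducedMetric E (∁ ⁅ x ⁆)
  vertex-deleted-metrics E? ds {ok} x = lookup ds x , toWitness ok x

distances : Vec (Vec ℕ 6) 6 → Fin 6 → Fin 6 → ℚ
distances table x y = + lookup (lookup table x) y / 1

rotated : (Fin 6 → Fin 6 → ℚ) → Fin 6 → Fin 6 → ℚ
rotated d x y = d (rotate⁻¹ x) (rotate⁻¹ y)
  where
  rotate⁻¹ : Fin 6 → Fin 6
  rotate⁻¹ = lookup (a₃ ∷ b₃ ∷ a₁ ∷ b₁ ∷ a₂ ∷ b₂ ∷ [])

orbit : (Fin 6 → Fin 6 → ℚ) → (Fin 6 → Fin 6 → ℚ) → Vec (Fin 6 → Fin 6 → ℚ) 6
orbit without-a₁ without-b₁ =
  without-a₁ ∷ without-b₁ ∷ rotated without-a₁ ∷ rotated without-b₁ ∷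
  rotated (rotated without-a₁) ∷ rotated (rotated without-b₁) ∷ []

-- Vertex order a₁ b₁ a₂ b₂ a₃ b₃.
without-a₁ : Fin 6 → Fin 6 → ℚ
without-a₁ = distances
  ( (0 ∷ 0 ∷ 0 ∷ 0 ∷ 0 ∷ 0 ∷ [])
  ∷ (0 ∷ 0 ∷ 2 ∷ 3 ∷ 3 ∷ 2 ∷ [])
  ∷ (0 ∷ 2 ∷ 0 ∷ 1 ∷ 1 ∷ 2 ∷ [])
  ∷ (0 ∷ 3 ∷ 1 ∷ 0 ∷ 2 ∷ 1 ∷ [])
  ∷ (0 ∷ 3 ∷ 1 ∷ 2 ∷ 0 ∷ 1 ∷ [])
  ∷ (0 ∷ 2 ∷ 2 ∷ 1 ∷ 1 ∷ 0 ∷ [])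
  ∷ [])

ℰ₂-without-b₁ : Fin 6 → Fin 6 → ℚ
ℰ₂-without-b₁ = distances
  ( (0 ∷ 0 ∷ 2 ∷ 3 ∷ 2 ∷ 3 ∷ [])
  ∷ (0 ∷ 0 ∷ 0 ∷ 0 ∷ 0 ∷ 0 ∷ [])
  ∷ (2 ∷ 0 ∷ 0 ∷ 1 ∷ 2 ∷ 1 ∷ [])
  ∷ (3 ∷ 0 ∷ 1 ∷ 0 ∷ 1 ∷ 2 ∷ [])
  ∷ (2 ∷ 0 ∷ 2 ∷ 1 ∷ 0 ∷ 1 ∷ [])
  ∷ (3 ∷ 0 ∷ 1 ∷ 2 ∷ 1 ∷ 0 ∷ [])
  ∷ [])

ℰ₃-without-b₁ : Fin 6 → Fin 6 → ℚ
ℰ₃-without-b₁ = distances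
  ( (0 ∷ 0 ∷ 1 ∷ 2 ∷ 1 ∷ 2 ∷ [])
  ∷ (0 ∷ 0 ∷ 0 ∷ 0 ∷ 0 ∷ 0 ∷ [])
  ∷ (1 ∷ 0 ∷ 0 ∷ 1 ∷ 2 ∷ 1 ∷ [])
  ∷ (2 ∷ 0 ∷ 1 ∷ 0 ∷ 1 ∷ 2 ∷ [])
  ∷ (1 ∷ 0 ∷ 2 ∷ 1 ∷ 0 ∷ 1 ∷ [])
  ∷ (2 ∷ 0 ∷ 1 ∷ 2 ∷ 1 ∷ 0 ∷ [])
  ∷ [])

theorem4 : MinimalNonMetric ℰ₂ × MinimalNonMetric ℰ₃
theorem4 =
  ( ℰ₂⊆E⊆ℰ₃⇒non-metric id proj₁
  , proper-induced-metric (vertex-deleted-metrics ℰ₂? (orbit without-a₁ ℰ₂-without-b₁)) )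
  , ( ℰ₂⊆E⊆ℰ₃⇒non-metric proj₁ id
  , proper-induced-metric (vertex-deleted-metrics ℰ₃? (orbit without-a₁ ℰ₃-without-b₁)) )
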